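{- For nonnegative integers $n$ and $r$ and any $y$, \[ \tilde{w}_{n,r}(y)-(r+1)\tilde{w}_{n,r+1}(y)=y^{r}\sum_{k=r}^{n}\binom{n}{k}{k\brace r}\phi_{n-k}(-y). \]
   Context: ${n\brace k}$ denotes the Stirling number of the second kind. $\phi_n(y)=\sum_{k=0}^n{n\brace k}y^k$ are the exponential polynomials. $d_{k,r}$ is the number of permutations of a $k$-set with exactly $r$ fixed points ($d_{k,r}=\binom{k}{r}d_{k-r}$ for $k\ge r$, $0$ otherwise, $d_m=m!\sum_{i=0}^m(-1)^i/i!$), and $\tilde{w}_{n,r}(y)=\sum_{k=0}^n{n\brace k}d_{k,r}y^k$. -}

module Defs where

open import Level using (Level)
open import Data.Nat as ℕ using (ℕ; zero; suc; _∸_; _!)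
open import Data.Nat.Properties using (_!≢0)
open import Data.Nat.Combinatorics using (_C_)
open import Data.Integer as ℤ using (ℤ; +_; -[1+_])
open import Algebra.Bundles using (CommutativeRing; Semiring)
open import Relation.Nullary using (yes; no)

stirling2 : ℕ → ℕ → ℕ
stirling2 zero    zero    = 1
stirling2 zero    (suc k) = 0
stirling2 (suc n) zero    = 0
stirling2 (suc n) (suc k) = suc k ℕ.* stirling2 n (suc k) ℕ.+ stirling2 n k

sumℤ : ℕ → (ℕ → ℤ) → ℤ
sumℤ zero    f = f 0
sumℤ (suc n) f = sumℤ n f ℤ.+ f (suc n)

signℤ : ℕ → ℤ
signℤ zero    = + 1
signℤ (suc i) = ℤ.- signℤ i

ratioFact : ℕ → ℕ → ℕ
ratioFact m i = (m ! ℕ./ i !) {{i !≢0}}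

-- derangement numbers d_m = m! Σ_{i=0}^m (-1)^i / i!  =  Σ_{i=0}^m (-1)^i m!/i!
derangement : ℕ → ℤ
derangement m = sumℤ m (λ i → signℤ i ℤ.* + ratioFact m i)

dkr : ℕ → ℕ → ℤ
dkr k r with r ℕ.≤? k
... | yes _ = + (k C r) ℤ.* derangement (k ∸ r)
... | no _ = + 0

module _ {c ℓ : Level} (R : CommutativeRing c ℓ) where
  open CommutativeRing R
  open import Algebra.Definitions.RawSemiring (Semiring.rawSemiring semiring) using (_×_; _^_)

  fromℤ : ℤ → Carrier
  fromℤ (+ n)      = n × 1#
  fromℤ -[1+ n ]   = - (suc n × 1#)

  -- Σ_{k=a}^{n} f k in R (empty sum 0# when a > n)
  sumFromTo : ℕ → ℕ → (ℕ → Carrier) → Carrier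
  sumFromTo a zero    f with a
  ... | zero  = f 0
  ... | suc _ = 0#
  sumFromTo a (suc n) f with a ℕ.≤? suc n
  ... | yes _ = sumFromTo a n f + f (suc n)
  ... | no _ = 0#

  phi : ℕ → Carrier → Carrier
  phi n y = sumFromTo 0 n (λ k → stirling2 n k × (y ^ k))

  wTilde : ℕ → ℕ → Carrier → Carrier
  wTilde n r y = sumFromTo 0 n (λ k → (stirling2 n k × fromℤ (dkr k r)) * (y ^ k))

{-# OPTIONS --safe #-}
module Submission where

-- Both sides equal Σₖ C(k,r) S(n,k) (-1)^(k-r) y^k, where S = stirling2.
-- On the left this holds termwise by d_{k,r} - (r+1) d_{k,r+1} = C(k,r) (-1)^(k-r), which follows
-- from the recurrence d_{m+1} = (m+1) d_m + (-1)^(m+1) and the absorption identity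
-- (r+1) C(k,r+1) = (k-r) C(k,r).
-- On the right, expanding φ_{n-k}(-y) and exchanging the two sums leaves as coefficient of (-y)^j
-- the binomial convolution Σₖ C(n,k) S(k,r) S(n-k,j) = C(r+j,r) S(n,r+j) (partitions into r + j
-- blocks, r of them marked). It follows by induction on n from the Leibniz rule
-- conv_{n+1}(f,g) = conv_n(f ∘ suc, g) + conv_n(f, g ∘ suc) and the recurrence of S.

open import Level using (Level)
open import Function.Base using (_∘_)
open import Algebra.Bundles using (Semiring; CommutativeRing)
open import Data.Fin.Base using (toℕ)
open import Data.Fin.Properties using (toℕ<n)
open import Data.Nat.Base as ℕ using (ℕ; zero; suc; _∸_; _≤_; _<_; s≤s)
import Data.Nat.Properties as ℕ
open import Data.Nat.Combinatorics
  using (_C_; nCn≡1; nC1≡n; nCk≡nC[n∸k]; k>n⇒nCk≡0; nCk+nC[k+1]≡[n+1]C[k+1])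

open import Defs

module FiniteSum {c ℓ : Level} (S : Semiring c ℓ) where
  open Semiring S
  open import Algebra.Properties.Semiring.Sum S
    using (sum; sum-cong-≋; ∑-distrib-+; ∑-comm; *-distribˡ-sum)
  open import Relation.Binary.Reasoning.Setoid setoid

  -- Opaque, so that unification sees ∑ N f rather than its unfolding over Fin N.
  opaque
    ∑ : ℕ → (ℕ → Carrier) → Carrier
    ∑ N f = sum {N} (f ∘ toℕ)

    ∑-empty : ∀ (f : ℕ → Carrier) → ∑ 0 f ≈ 0#
    ∑-empty f = refl

    ∑-suc : ∀ N (f : ℕ → Carrier) → ∑ (suc N) f ≈ f 0 + ∑ N (f ∘ suc)
    ∑-suc N f = refl

    ∑-one : ∀ (f : ℕ → Carrier) → ∑ 1 f ≈ f 0
    ∑-one f = +-identityʳ (f 0)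

    ∑-snoc : ∀ N (f : ℕ → Carrier) → ∑ (suc N) f ≈ ∑ N f + f N
    ∑-snoc zero    f = trans (+-identityʳ _) (sym (+-identityˡ _))
    ∑-snoc (suc N) f = trans (+-congˡ (∑-snoc N (f ∘ suc))) (sym (+-assoc _ _ _))

    ∑-split : ∀ M N (f : ℕ → Carrier) → ∑ (M ℕ.+ N) f ≈ ∑ M f + ∑ N (λ j → f (M ℕ.+ j))
    ∑-split zero    N f = sym (+-identityˡ _)
    ∑-split (suc M) N f = trans (+-congˡ (∑-split M N (f ∘ suc))) (sym (+-assoc _ _ _))

    ∑-cong : ∀ N {f g : ℕ → Carrier} → (∀ k → k < N → f k ≈ g k) → ∑ N f ≈ ∑ N g
    ∑-cong N f≈g = sum-cong-≋ (λ i → f≈g (toℕ i) (toℕ<n i))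

    ∑-zero : ∀ N (f : ℕ → Carrier) → (∀ k → k < N → f k ≈ 0#) → ∑ N f ≈ 0#
    ∑-zero zero    f f≈0 = refl
    ∑-zero (suc N) f f≈0 =
      trans (+-cong (f≈0 0 (s≤s ℕ.z≤n)) (∑-zero N (f ∘ suc) (λ k k<N → f≈0 (suc k) (s≤s k<N))))
            (+-identityˡ 0#)

    ∑-+ : ∀ N (f g : ℕ → Carrier) → ∑ N (λ k → f k + g k) ≈ ∑ N f + ∑ N g
    ∑-+ N f g = ∑-distrib-+ {N} (f ∘ toℕ) (g ∘ toℕ)

    *-distribˡ-∑ : ∀ N x (f : ℕ → Carrier) → x * ∑ N f ≈ ∑ N (λ k → x * f k)
    *-distribˡ-∑ N x f = *-distribˡ-sum {N} x (f ∘ toℕ)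

    ∑-swap : ∀ M N (f : ℕ → ℕ → Carrier) →
             ∑ M (λ i → ∑ N (f i)) ≈ ∑ N (λ j → ∑ M (λ i → f i j))
    ∑-swap M N f = ∑-comm {M} {N} (λ i j → f (toℕ i) (toℕ j))

  ∑-zero-prefix : ∀ M N (f : ℕ → Carrier) → (∀ k → k < M → f k ≈ 0#) →
                  ∑ (M ℕ.+ N) f ≈ ∑ N (λ j → f (M ℕ.+ j))
  ∑-zero-prefix M N f f≈0 = begin
    ∑ (M ℕ.+ N) f                      ≈⟨ ∑-split M N f ⟩
    ∑ M f + ∑ N (λ j → f (M ℕ.+ j))    ≈⟨ +-congʳ (∑-zero M f f≈0) ⟩
    0# + ∑ N (λ j → f (M ℕ.+ j))       ≈⟨ +-identityˡ _ ⟩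
    ∑ N (λ j → f (M ℕ.+ j))            ∎

  ∑-zero-suffix : ∀ M N (f : ℕ → Carrier) → (∀ k → M ≤ k → f k ≈ 0#) → ∑ (M ℕ.+ N) f ≈ ∑ M f
  ∑-zero-suffix M N f f≈0 = begin
    ∑ (M ℕ.+ N) f                      ≈⟨ ∑-split M N f ⟩
    ∑ M f + ∑ N (λ j → f (M ℕ.+ j))    ≈⟨ +-congˡ (∑-zero N _ (λ j _ → f≈0 (M ℕ.+ j) (ℕ.m≤m+n M j))) ⟩
    ∑ M f + 0#                         ≈⟨ +-identityʳ _ ⟩
    ∑ M f                              ∎

module Binomial where
  open import Data.Nat.Base using (_+_; _*_)
  open import Data.Nat.Tactic.RingSolver using (solve-∀)
  open import Relation.Binary.PropositionalEquality using (_≡_; refl; sym; trans; cong; cong₂; module ≡-Reasoning)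
  open ≡-Reasoning

  [k+1]*[n+1]C[k+1]≡[n+1]*nCk : ∀ n k → suc k * (suc n C suc k) ≡ suc n * (n C k)
  [k+1]*[n+1]C[k+1]≡[n+1]*nCk zero    zero    = refl
  [k+1]*[n+1]C[k+1]≡[n+1]*nCk zero    (suc k) = ℕ.*-zeroʳ (suc (suc k))
  [k+1]*[n+1]C[k+1]≡[n+1]*nCk (suc n) zero    =
    trans (ℕ.*-identityˡ (suc (suc n) C 1)) (trans (nC1≡n (suc (suc n))) (sym (ℕ.*-identityʳ (suc (suc n)))))
  [k+1]*[n+1]C[k+1]≡[n+1]*nCk (suc n) (suc k) = begin
    suc (suc k) * (suc (suc n) C suc (suc k))
      ≡⟨ cong (suc (suc k) *_) (nCk+nC[k+1]≡[n+1]C[k+1] (suc n) (suc k)) ⟨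
    suc (suc k) * ((suc n C suc k) + (suc n C suc (suc k)))
      ≡⟨ regroup (suc k) (suc n C suc k) (suc n C suc (suc k)) ⟩
    (suc n C suc k) + (suc k * (suc n C suc k) + suc (suc k) * (suc n C suc (suc k)))
      ≡⟨ cong₂ (λ a b → (suc n C suc k) + (a + b))
               ([k+1]*[n+1]C[k+1]≡[n+1]*nCk n k) ([k+1]*[n+1]C[k+1]≡[n+1]*nCk n (suc k)) ⟩
    (suc n C suc k) + (suc n * (n C k) + suc n * (n C suc k))
      ≡⟨ cong ((suc n C suc k) +_) (ℕ.*-distribˡ-+ (suc n) (n C k) (n C suc k)) ⟨
    (suc n C suc k) + suc n * ((n C k) + (n C suc k))
      ≡⟨ cong (λ c → (suc n C suc k) + suc n * c) (nCk+nC[k+1]≡[n+1]C[k+1] n k) ⟩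
    suc (suc n) * (suc n C suc k) ∎
    where
    regroup : ∀ a x y → suc a * (x + y) ≡ x + (a * x + suc a * y)
    regroup = solve-∀

  [n∸k+1]*[n+1]Ck≡[n+1]*nCk : ∀ {n k} → k ≤ n → suc (n ∸ k) * (suc n C k) ≡ suc n * (n C k)
  [n∸k+1]*[n+1]Ck≡[n+1]*nCk {n} {k} k≤n = begin
    suc (n ∸ k) * (suc n C k)            ≡⟨ cong (suc (n ∸ k) *_) (nCk≡nC[n∸k] (ℕ.m≤n⇒m≤1+n k≤n)) ⟩
    suc (n ∸ k) * (suc n C (suc n ∸ k))  ≡⟨ cong (λ i → suc (n ∸ k) * (suc n C i)) (ℕ.+-∸-assoc 1 k≤n) ⟩
    suc (n ∸ k) * (suc n C suc (n ∸ k))  ≡⟨ [k+1]*[n+1]C[k+1]≡[n+1]*nCk n (n ∸ k) ⟩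
    suc n * (n C (n ∸ k))                ≡⟨ cong (suc n *_) (nCk≡nC[n∸k] k≤n) ⟨
    suc n * (n C k)                      ∎

module BinomialConvolution where
  open import Data.Nat.Base using (_+_; _*_)
  open import Data.Nat.Tactic.RingSolver using (solve-∀)
  open import Algebra.Properties.CommutativeSemigroup ℕ.+-commutativeSemigroup using (x∙yz≈y∙xz)
  open import Relation.Binary.PropositionalEquality using (_≡_; sym; trans; cong; cong₂; module ≡-Reasoning)
  open FiniteSum ℕ.+-*-semiring
  open ≡-Reasoning

  binomialConvolution : ℕ → (ℕ → ℕ) → (ℕ → ℕ) → ℕ
  binomialConvolution n f g = ∑ (suc n) (λ k → (n C k) * f k * g (n ∸ k))

  binomialConvolution-zero : ∀ f g → binomialConvolution 0 f g ≡ f 0 * g 0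
  binomialConvolution-zero f g = begin
    binomialConvolution 0 f g  ≡⟨ ∑-one (λ k → (0 C k) * f k * g (0 ∸ k)) ⟩
    1 * f 0 * g 0              ≡⟨ cong (_* g 0) (ℕ.*-identityˡ (f 0)) ⟩
    f 0 * g 0                  ∎

  binomialConvolution-zeroˡ : ∀ n g → binomialConvolution n (λ _ → 0) g ≡ 0
  binomialConvolution-zeroˡ n g =
    ∑-zero (suc n) (λ k → (n C k) * 0 * g (n ∸ k)) (λ k _ → cong (_* g (n ∸ k)) (ℕ.*-zeroʳ (n C k)))

  binomialConvolution-zeroʳ : ∀ n f → binomialConvolution n f (λ _ → 0) ≡ 0
  binomialConvolution-zeroʳ n f =
    ∑-zero (suc n) (λ k → (n C k) * f k * 0) (λ k _ → ℕ.*-zeroʳ ((n C k) * f k))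

  binomialConvolution-linearˡ : ∀ n a f f′ g →
    binomialConvolution n (λ k → a * f k + f′ k) g ≡ a * binomialConvolution n f g + binomialConvolution n f′ g
  binomialConvolution-linearˡ n a f f′ g = begin
    binomialConvolution n (λ k → a * f k + f′ k) g
      ≡⟨ ∑-cong (suc n) (λ k _ → distrib (n C k) a (f k) (f′ k) (g (n ∸ k))) ⟩
    ∑ (suc n) (λ k → a * t f k + t f′ k)
      ≡⟨ ∑-+ (suc n) (λ k → a * t f k) (t f′) ⟩
    ∑ (suc n) (λ k → a * t f k) + binomialConvolution n f′ g
      ≡⟨ cong (_+ binomialConvolution n f′ g) (*-distribˡ-∑ (suc n) a (t f)) ⟨
    a * binomialConvolution n f g + binomialConvolution n f′ g ∎
    where
    t : (ℕ → ℕ) → ℕ → ℕ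
    t h k = (n C k) * h k * g (n ∸ k)
    distrib : ∀ c a x x′ z → c * (a * x + x′) * z ≡ a * (c * x * z) + c * x′ * z
    distrib = solve-∀

  binomialConvolution-linearʳ : ∀ n a f g g′ →
    binomialConvolution n f (λ k → a * g k + g′ k) ≡ a * binomialConvolution n f g + binomialConvolution n f g′
  binomialConvolution-linearʳ n a f g g′ = begin
    binomialConvolution n f (λ k → a * g k + g′ k)
      ≡⟨ ∑-cong (suc n) (λ k _ → distrib ((n C k) * f k) a (g (n ∸ k)) (g′ (n ∸ k))) ⟩
    ∑ (suc n) (λ k → a * t g k + t g′ k)
      ≡⟨ ∑-+ (suc n) (λ k → a * t g k) (t g′) ⟩
    ∑ (suc n) (λ k → a * t g k) + binomialConvolution n f g′
      ≡⟨ cong (_+ binomialConvolution n f g′) (*-distribˡ-∑ (suc n) a (t g)) ⟨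
    a * binomialConvolution n f g + binomialConvolution n f g′ ∎
    where
    t : (ℕ → ℕ) → ℕ → ℕ
    t h k = (n C k) * f k * h (n ∸ k)
    distrib : ∀ c a z z′ → c * (a * z + z′) ≡ a * (c * z) + c * z′
    distrib = solve-∀

  binomialConvolution-suc : ∀ n f g →
    binomialConvolution (suc n) f g ≡ binomialConvolution n (f ∘ suc) g + binomialConvolution n f (g ∘ suc)
  binomialConvolution-suc n f g = begin
    binomialConvolution (suc n) f g
      ≡⟨ ∑-suc (suc n) (λ k → (suc n C k) * f k * g (suc n ∸ k)) ⟩
    first + ∑ (suc n) (λ k → (suc n C suc k) * f (suc k) * g (n ∸ k))
      ≡⟨ cong (first +_) (trans (∑-cong (suc n) (λ k _ → pascal k))
                                (∑-+ (suc n) (λ k → (n C k) * f (suc k) * g (n ∸ k)) rest)) ⟩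
    first + (binomialConvolution n (f ∘ suc) g + ∑ (suc n) rest)
      ≡⟨ x∙yz≈y∙xz first (binomialConvolution n (f ∘ suc) g) (∑ (suc n) rest) ⟩
    binomialConvolution n (f ∘ suc) g + (first + ∑ (suc n) rest)
      ≡⟨ cong (λ s → binomialConvolution n (f ∘ suc) g + (first + s)) rest-sum ⟩
    binomialConvolution n (f ∘ suc) g + (first + ∑ n (λ k → (n C suc k) * f (suc k) * g (suc (n ∸ suc k))))
      ≡⟨ cong (binomialConvolution n (f ∘ suc) g +_) (∑-suc n (λ k → (n C k) * f k * g (suc (n ∸ k)))) ⟨
    binomialConvolution n (f ∘ suc) g + binomialConvolution n f (g ∘ suc) ∎
    where
    first : ℕ
    first = 1 * f 0 * g (suc n)
    rest : ℕ → ℕ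
    rest k = (n C suc k) * f (suc k) * g (n ∸ k)
    pascal : ∀ k → (suc n C suc k) * f (suc k) * g (n ∸ k) ≡ (n C k) * f (suc k) * g (n ∸ k) + rest k
    pascal k = trans (cong (λ c → c * f (suc k) * g (n ∸ k)) (sym (nCk+nC[k+1]≡[n+1]C[k+1] n k)))
                     (distrib (n C k) (n C suc k) (f (suc k)) (g (n ∸ k)))
      where
      distrib : ∀ a b x z → (a + b) * x * z ≡ a * x * z + b * x * z
      distrib = solve-∀
    rest-sum : ∑ (suc n) rest ≡ ∑ n (λ k → (n C suc k) * f (suc k) * g (suc (n ∸ suc k)))
    rest-sum = begin
      ∑ (suc n) rest
        ≡⟨ ∑-snoc n rest ⟩
      ∑ n rest + rest n
        ≡⟨ cong₂ _+_ (∑-cong n (λ k k<n → cong (λ i → (n C suc k) * f (suc k) * g i) (ℕ.+-∸-assoc 1 k<n)))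
                     (cong (λ c → c * f (suc n) * g (n ∸ n)) (k>n⇒nCk≡0 (ℕ.n<1+n n))) ⟩
      ∑ n (λ k → (n C suc k) * f (suc k) * g (suc (n ∸ suc k))) + 0
        ≡⟨ ℕ.+-identityʳ _ ⟩
      ∑ n (λ k → (n C suc k) * f (suc k) * g (suc (n ∸ suc k))) ∎

module Stirling where
  open import Data.Nat.Base using (_+_; _*_)
  open import Data.Nat.Tactic.RingSolver using (solve-∀)
  open import Relation.Binary.PropositionalEquality using (_≡_; refl; sym; trans; cong; cong₂; module ≡-Reasoning)
  open BinomialConvolution
  open ≡-Reasoning

  stirling2-vanish : ∀ {n k} → n < k → stirling2 n k ≡ 0
  stirling2-vanish {zero}  {suc k} _          = refl
  stirling2-vanish {suc n} {suc k} (s≤s n<k) = begin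
    suc k * stirling2 n (suc k) + stirling2 n k
      ≡⟨ cong₂ (λ a b → suc k * a + b) (stirling2-vanish (ℕ.m<n⇒m<1+n n<k)) (stirling2-vanish n<k) ⟩
    suc k * 0 + 0
      ≡⟨ trans (ℕ.+-identityʳ _) (ℕ.*-zeroʳ (suc k)) ⟩
    0 ∎

  private
    column : ℕ → ℕ → ℕ
    column r k = stirling2 k r

    T : ℕ → ℕ → ℕ → ℕ
    T n r j = binomialConvolution n (column r) (column j)

  stirling2-convolution : ∀ n {r j m} → r + j ≡ m →
    binomialConvolution n (λ k → stirling2 k r) (λ k → stirling2 k j) ≡ (m C r) * stirling2 n m
  stirling2-convolution zero {zero}  {zero}  refl = binomialConvolution-zero (column 0) (column 0)
  stirling2-convolution zero {zero}  {suc j} refl = binomialConvolution-zero (column 0) (column (suc j))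
  stirling2-convolution zero {suc r} {j}     refl =
    trans (binomialConvolution-zero (column (suc r)) (column j)) (sym (ℕ.*-zeroʳ ((suc r + j) C suc r)))
  stirling2-convolution (suc n) {zero} {zero} refl =
    trans (binomialConvolution-suc n (column 0) (column 0))
          (cong₂ _+_ (binomialConvolution-zeroˡ n (column 0)) (binomialConvolution-zeroʳ n (column 0)))
  stirling2-convolution (suc n) {zero} {suc j} refl = begin
    T (suc n) 0 (suc j)
      ≡⟨ binomialConvolution-suc n (column 0) (column (suc j)) ⟩
    binomialConvolution n (λ _ → 0) (column (suc j))
      + binomialConvolution n (column 0) (λ k → suc j * stirling2 k (suc j) + stirling2 k j)
      ≡⟨ cong₂ _+_ (binomialConvolution-zeroˡ n (column (suc j)))
                   (binomialConvolution-linearʳ n (suc j) (column 0) (column (suc j)) (column j)) ⟩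
    suc j * T n 0 (suc j) + T n 0 j
      ≡⟨ cong₂ (λ a b → suc j * a + b) (stirling2-convolution n {0} {suc j} refl)
                                       (stirling2-convolution n {0} {j} refl) ⟩
    suc j * (1 * stirling2 n (suc j)) + 1 * stirling2 n j
      ≡⟨ regroup (suc j) (stirling2 n (suc j)) (stirling2 n j) ⟩
    1 * stirling2 (suc n) (suc j) ∎
    where
    regroup : ∀ a x y → a * (1 * x) + 1 * y ≡ 1 * (a * x + y)
    regroup = solve-∀
  stirling2-convolution (suc n) {suc r} {zero} refl rewrite ℕ.+-identityʳ r = begin
    T (suc n) (suc r) 0
      ≡⟨ binomialConvolution-suc n (column (suc r)) (column 0) ⟩
    binomialConvolution n (λ k → suc r * stirling2 k (suc r) + stirling2 k r) (column 0)
      + binomialConvolution n (column (suc r)) (λ _ → 0)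
      ≡⟨ cong₂ _+_ (binomialConvolution-linearˡ n (suc r) (column (suc r)) (column r) (column 0))
                   (binomialConvolution-zeroʳ n (column (suc r))) ⟩
    suc r * T n (suc r) 0 + T n r 0 + 0
      ≡⟨ cong₂ (λ a b → suc r * a + b + 0) (stirling2-convolution n {suc r} {0} (cong suc (ℕ.+-identityʳ r)))
                                            (stirling2-convolution n {r} {0} (ℕ.+-identityʳ r)) ⟩
    suc r * ((suc r C suc r) * stirling2 n (suc r)) + (r C r) * stirling2 n r + 0
      ≡⟨ cong₂ (λ a b → suc r * (a * stirling2 n (suc r)) + b * stirling2 n r + 0)
               (nCn≡1 (suc r)) (nCn≡1 r) ⟩
    suc r * (1 * stirling2 n (suc r)) + 1 * stirling2 n r + 0
      ≡⟨ regroup (suc r) (stirling2 n (suc r)) (stirling2 n r) ⟩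
    1 * stirling2 (suc n) (suc r)
      ≡⟨ cong (_* stirling2 (suc n) (suc r)) (nCn≡1 (suc r)) ⟨
    (suc r C suc r) * stirling2 (suc n) (suc r) ∎
    where
    regroup : ∀ a x y → a * (1 * x) + 1 * y + 0 ≡ 1 * (a * x + y)
    regroup = solve-∀
  stirling2-convolution (suc n) {suc r} {suc j} refl = begin
    T (suc n) (suc r) (suc j)
      ≡⟨ binomialConvolution-suc n (column (suc r)) (column (suc j)) ⟩
    binomialConvolution n (λ k → suc r * stirling2 k (suc r) + stirling2 k r) (column (suc j))
      + binomialConvolution n (column (suc r)) (λ k → suc j * stirling2 k (suc j) + stirling2 k j)
      ≡⟨ cong₂ _+_ (binomialConvolution-linearˡ n (suc r) (column (suc r)) (column r) (column (suc j)))
                   (binomialConvolution-linearʳ n (suc j) (column (suc r)) (column (suc j)) (column j)) ⟩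
    suc r * T n (suc r) (suc j) + T n r (suc j) + (suc j * T n (suc r) (suc j) + T n (suc r) j)
      ≡⟨ cong₂ (λ a b → suc r * a + b + (suc j * a + T n (suc r) j))
               (stirling2-convolution n {suc r} {suc j} refl) (stirling2-convolution n {r} {suc j} refl) ⟩
    suc r * ((suc p C suc r) * X) + (p C r) * Y + (suc j * ((suc p C suc r) * X) + T n (suc r) j)
      ≡⟨ cong (λ c → suc r * ((suc p C suc r) * X) + (p C r) * Y + (suc j * ((suc p C suc r) * X) + c))
              (stirling2-convolution n {suc r} {j} (sym (ℕ.+-suc r j))) ⟩
    suc r * ((suc p C suc r) * X) + (p C r) * Y + (suc j * ((suc p C suc r) * X) + (p C suc r) * Y)
      ≡⟨ cong (λ c → suc r * (c * X) + (p C r) * Y + (suc j * (c * X) + (p C suc r) * Y))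
              (nCk+nC[k+1]≡[n+1]C[k+1] p r) ⟨
    suc r * (((p C r) + (p C suc r)) * X) + (p C r) * Y + (suc j * (((p C r) + (p C suc r)) * X) + (p C suc r) * Y)
      ≡⟨ regroup r j (p C r) (p C suc r) X Y ⟩
    ((p C r) + (p C suc r)) * stirling2 (suc n) (suc p)
      ≡⟨ cong (_* stirling2 (suc n) (suc p)) (nCk+nC[k+1]≡[n+1]C[k+1] p r) ⟩
    (suc p C suc r) * stirling2 (suc n) (suc p) ∎
    where
    p X Y : ℕ
    p = r + suc j
    X = stirling2 n (suc p)
    Y = stirling2 n p
    regroup : ∀ r j c c′ x y → suc r * ((c + c′) * x) + c * y + (suc j * ((c + c′) * x) + c′ * y)
                             ≡ (c + c′) * ((suc r + suc j) * x + y)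
    regroup = solve-∀

module Derangements where
  open import Data.Nat.Base using (_!)
  open import Data.Nat.DivMod using (*-/-assoc; n/n≡1)
  open import Data.Nat.Divisibility using (m≤n⇒m!∣n!)
  open import Data.Nat.Properties using (_!≢0)
  open import Data.Integer.Base using (ℤ; +_; _+_; _*_; _-_)
  open import Data.Integer.Properties using (pos-*; *-assoc; *-identityʳ; *-distribˡ-+)
  open import Data.Integer.Tactic.RingSolver using (solve-∀)
  open import Relation.Binary.Definitions using (tri<; tri≈; tri>)
  open import Relation.Nullary.Decidable using (yes; no)
  open import Relation.Nullary.Negation using (contradiction)
  open import Relation.Binary.PropositionalEquality using (_≡_; refl; sym; trans; cong; cong₂; module ≡-Reasoning)
  open Binomial
  open ≡-Reasoning

  sumℤ-cong : ∀ m {f g : ℕ → ℤ} → (∀ i → i ≤ m → f i ≡ g i) → sumℤ m f ≡ sumℤ m g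
  sumℤ-cong zero    f≡g = f≡g 0 ℕ.z≤n
  sumℤ-cong (suc m) f≡g =
    cong₂ _+_ (sumℤ-cong m (λ i i≤m → f≡g i (ℕ.m≤n⇒m≤1+n i≤m))) (f≡g (suc m) ℕ.≤-refl)

  *-distribˡ-sumℤ : ∀ m a (f : ℕ → ℤ) → a * sumℤ m f ≡ sumℤ m (λ i → a * f i)
  *-distribˡ-sumℤ zero    a f = refl
  *-distribˡ-sumℤ (suc m) a f =
    trans (*-distribˡ-+ a (sumℤ m f) (f (suc m))) (cong (_+ a * f (suc m)) (*-distribˡ-sumℤ m a f))

  ratioFact-suc : ∀ {m i} → i ≤ m → ratioFact (suc m) i ≡ suc m ℕ.* ratioFact m i
  ratioFact-suc {m} {i} i≤m = *-/-assoc (suc m) {{i !≢0}} (m≤n⇒m!∣n! i≤m)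

  ratioFact-diag : ∀ m → ratioFact m m ≡ 1
  ratioFact-diag m = n/n≡1 (m !) {{m !≢0}}

  derangement-suc : ∀ m → derangement (suc m) ≡ + suc m * derangement m + signℤ (suc m)
  derangement-suc m = cong₂ _+_ scaled-sum last-term
    where
    swap : ∀ a b c → a * (b * c) ≡ b * (a * c)
    swap = solve-∀
    scaled-sum : sumℤ m (λ i → signℤ i * + ratioFact (suc m) i) ≡ + suc m * derangement m
    scaled-sum = begin
      sumℤ m (λ i → signℤ i * + ratioFact (suc m) i)
        ≡⟨ sumℤ-cong m (λ i i≤m → trans (cong (λ q → signℤ i * + q) (ratioFact-suc i≤m))
                                         (cong (signℤ i *_) (pos-* (suc m) (ratioFact m i)))) ⟩
      sumℤ m (λ i → signℤ i * (+ suc m * + ratioFact m i))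
        ≡⟨ sumℤ-cong m (λ i _ → swap (signℤ i) (+ suc m) (+ ratioFact m i)) ⟩
      sumℤ m (λ i → + suc m * (signℤ i * + ratioFact m i))
        ≡⟨ *-distribˡ-sumℤ m (+ suc m) (λ i → signℤ i * + ratioFact m i) ⟨
      + suc m * derangement m ∎
    last-term : signℤ (suc m) * + ratioFact (suc m) (suc m) ≡ signℤ (suc m)
    last-term = trans (cong (λ q → signℤ (suc m) * + q) (ratioFact-diag (suc m))) (*-identityʳ _)

  dkr-≤ : ∀ {k r} → r ≤ k → dkr k r ≡ + (k C r) * derangement (k ∸ r)
  dkr-≤ {k} {r} r≤k with r ℕ.≤? k
  ... | yes _   = refl
  ... | no  r≰k = contradiction r≤k r≰k

  dkr-> : ∀ {k r} → k < r → dkr k r ≡ + 0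
  dkr-> {k} {r} k<r with r ℕ.≤? k
  ... | yes r≤k = contradiction r≤k (ℕ.<⇒≱ k<r)
  ... | no  _   = refl

  dkr-difference : ∀ k r → dkr k r - + suc r * dkr k (suc r) ≡ + (k C r) * signℤ (k ∸ r)
  dkr-difference k r with ℕ.<-cmp r k
  dkr-difference (suc n) r | tri< (s≤s r≤n) _ _ = begin
    dkr (suc n) r - + suc r * dkr (suc n) (suc r)
      ≡⟨ cong₂ (λ a b → a - + suc r * b) (dkr-≤ (ℕ.m≤n⇒m≤1+n r≤n)) (dkr-≤ (s≤s r≤n)) ⟩
    + c * derangement (suc n ∸ r) - + suc r * (+ (suc n C suc r) * derangement m)
      ≡⟨ cong (λ i → + c * derangement i - + suc r * (+ (suc n C suc r) * derangement m)) suc-m ⟩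
    + c * derangement (suc m) - + suc r * (+ (suc n C suc r) * derangement m)
      ≡⟨ cong₂ (λ a b → + c * a - b) (derangement-suc m) absorbed ⟩
    + c * (+ suc m * derangement m + signℤ (suc m)) - + suc m * + c * derangement m
      ≡⟨ cancel (+ c) (+ suc m) (derangement m) (signℤ (suc m)) ⟩
    + c * signℤ (suc m)
      ≡⟨ cong (λ i → + c * signℤ i) suc-m ⟨
    + c * signℤ (suc n ∸ r) ∎
    where
    m c : ℕ
    m = n ∸ r
    c = suc n C r
    suc-m : suc n ∸ r ≡ suc m
    suc-m = ℕ.+-∸-assoc 1 r≤n
    absorbed : + suc r * (+ (suc n C suc r) * derangement m) ≡ + suc m * + c * derangement m
    absorbed = begin
      + suc r * (+ (suc n C suc r) * derangement m)
        ≡⟨ *-assoc (+ suc r) (+ (suc n C suc r)) (derangement m) ⟨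
      + suc r * + (suc n C suc r) * derangement m
        ≡⟨ cong (_* derangement m) (pos-* (suc r) (suc n C suc r)) ⟨
      + (suc r ℕ.* (suc n C suc r)) * derangement m
        ≡⟨ cong (λ q → + q * derangement m)
                (trans ([k+1]*[n+1]C[k+1]≡[n+1]*nCk n r) (sym ([n∸k+1]*[n+1]Ck≡[n+1]*nCk r≤n))) ⟩
      + (suc m ℕ.* c) * derangement m
        ≡⟨ cong (_* derangement m) (pos-* (suc m) c) ⟩
      + suc m * + c * derangement m ∎
    cancel : ∀ c s d σ → c * (s * d + σ) - s * c * d ≡ c * σ
    cancel = solve-∀
  dkr-difference r r | tri≈ _ refl _ = begin
    dkr r r - + suc r * dkr r (suc r)
      ≡⟨ cong₂ (λ a b → a - + suc r * b) (dkr-≤ {r} ℕ.≤-refl) (dkr-> (ℕ.n<1+n r)) ⟩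
    + (r C r) * derangement (r ∸ r) - + suc r * + 0
      ≡⟨ drop-zero (+ (r C r) * derangement (r ∸ r)) (+ suc r) ⟩
    + (r C r) * derangement (r ∸ r)
      ≡⟨ cong (λ i → + (r C r) * derangement i) (ℕ.n∸n≡0 r) ⟩
    + (r C r) * + 1
      ≡⟨ cong (λ i → + (r C r) * signℤ i) (ℕ.n∸n≡0 r) ⟨
    + (r C r) * signℤ (r ∸ r) ∎
    where
    drop-zero : ∀ a s → a - s * + 0 ≡ a
    drop-zero = solve-∀
  dkr-difference k r | tri> _ _ k<r = begin
    dkr k r - + suc r * dkr k (suc r)
      ≡⟨ cong₂ (λ a b → a - + suc r * b) (dkr-> k<r) (dkr-> (ℕ.m<n⇒m<1+n k<r)) ⟩
    + 0 - + suc r * + 0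
      ≡⟨ vanish (+ suc r) ⟩
    + 0 * signℤ (k ∸ r)
      ≡⟨ cong (λ q → + q * signℤ (k ∸ r)) (k>n⇒nCk≡0 k<r) ⟨
    + (k C r) * signℤ (k ∸ r) ∎
    where
    vanish : ∀ s → + 0 - s * + 0 ≡ + 0
    vanish = solve-∀

  dkr-difference-scaled : ∀ s k r →
    + s * dkr k r - + suc r * (+ s * dkr k (suc r)) ≡ + ((k C r) ℕ.* s) * signℤ (k ∸ r)
  dkr-difference-scaled s k r = begin
    + s * dkr k r - + suc r * (+ s * dkr k (suc r))   ≡⟨ factor (+ s) (dkr k r) (+ suc r) (dkr k (suc r)) ⟩
    + s * (dkr k r - + suc r * dkr k (suc r))         ≡⟨ cong (+ s *_) (dkr-difference k r) ⟩
    + s * (+ (k C r) * signℤ (k ∸ r))                 ≡⟨ swap (+ s) (+ (k C r)) (signℤ (k ∸ r)) ⟩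
    + (k C r) * + s * signℤ (k ∸ r)                   ≡⟨ cong (_* signℤ (k ∸ r)) (pos-* (k C r) s) ⟨
    + ((k C r) ℕ.* s) * signℤ (k ∸ r)                 ∎
    where
    factor : ∀ a x b z → a * x - b * (a * z) ≡ a * (x - b * z)
    factor = solve-∀
    swap : ∀ a b c → a * (b * c) ≡ b * a * c
    swap = solve-∀

module _ {ℓ₁ ℓ₂ : Level} (R : CommutativeRing ℓ₁ ℓ₂) where
  open CommutativeRing R
  open import Algebra.Definitions.RawSemiring (Semiring.rawSemiring semiring) using (_×_; _^_)
  open import Algebra.Properties.Semiring.Mult semiring
    using (×-homo-+; ×-congʳ; ×-congˡ; ×-assocˡ; ×-assoc-*; ×-comm-*)
  open import Algebra.Properties.Semiring.Exp semiring using (^-homo-*)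
  open import Algebra.Properties.Ring ring using (-0#≈0#; -‿involutive; -‿distribˡ-*; -1*x≈-x)
  open import Algebra.Properties.AbelianGroup +-abelianGroup using (⁻¹-∙-comm)
  open import Algebra.Properties.CommutativeSemigroup +-commutativeSemigroup using (interchange)
  open import Algebra.Properties.CommutativeSemigroup *-commutativeSemigroup using (x∙yz≈y∙xz)
  open import Data.Integer.Base as ℤ using (+_; -[1+_])
  import Data.Integer.Properties as ℤ
  open import Relation.Nullary.Decidable using (yes; no)
  import Relation.Binary.PropositionalEquality as ≡
  open import Relation.Binary.Reasoning.Setoid setoid
  open FiniteSum semiring
  module NatSum = FiniteSum ℕ.+-*-semiring
  open BinomialConvolution using (binomialConvolution)
  open Stirling using (stirling2-vanish; stirling2-convolution)
  open Derangements using (dkr-difference-scaled)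

  fromℤ-homo-neg : ∀ a → fromℤ R (ℤ.- a) ≈ - fromℤ R a
  fromℤ-homo-neg (+ zero)  = sym -0#≈0#
  fromℤ-homo-neg (+ suc n) = refl
  fromℤ-homo-neg -[1+ n ]  = sym (-‿involutive _)

  fromℤ-homo-⊖ : ∀ m n → fromℤ R (m ℤ.⊖ n) ≈ m × 1# - n × 1#
  fromℤ-homo-⊖ zero    zero    = sym (-‿inverseʳ 0#)
  fromℤ-homo-⊖ (suc m) zero    = sym (trans (+-congˡ -0#≈0#) (+-identityʳ _))
  fromℤ-homo-⊖ zero    (suc n) = sym (+-identityˡ _)
  fromℤ-homo-⊖ (suc m) (suc n) = begin
    fromℤ R (suc m ℤ.⊖ suc n)        ≡⟨ ≡.cong (fromℤ R) (ℤ.[1+m]⊖[1+n]≡m⊖n m n) ⟩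
    fromℤ R (m ℤ.⊖ n)                ≈⟨ fromℤ-homo-⊖ m n ⟩
    m × 1# - n × 1#                  ≈⟨ +-identityˡ _ ⟨
    0# + (m × 1# - n × 1#)           ≈⟨ +-congʳ (-‿inverseʳ 1#) ⟨
    (1# - 1#) + (m × 1# - n × 1#)    ≈⟨ interchange 1# (- 1#) (m × 1#) (- (n × 1#)) ⟩
    (1# + m × 1#) + (- 1# - n × 1#)  ≈⟨ +-congˡ (⁻¹-∙-comm 1# (n × 1#)) ⟩
    suc m × 1# - suc n × 1#          ∎

  fromℤ-homo-+ : ∀ a b → fromℤ R (a ℤ.+ b) ≈ fromℤ R a + fromℤ R b
  fromℤ-homo-+ (+ m)    (+ n)    = ×-homo-+ 1# m n
  fromℤ-homo-+ (+ m)    -[1+ n ] = fromℤ-homo-⊖ m (suc n)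
  fromℤ-homo-+ -[1+ m ] (+ n)    = trans (fromℤ-homo-⊖ n (suc m)) (+-comm _ _)
  fromℤ-homo-+ -[1+ m ] -[1+ n ] = begin
    - (suc (suc (m ℕ.+ n)) × 1#)     ≡⟨ ≡.cong (λ i → - (suc i × 1#)) (ℕ.+-suc m n) ⟨
    - ((suc m ℕ.+ suc n) × 1#)       ≈⟨ -‿cong (×-homo-+ 1# (suc m) (suc n)) ⟩
    - (suc m × 1# + suc n × 1#)      ≈⟨ ⁻¹-∙-comm _ _ ⟨
    - (suc m × 1#) - suc n × 1#      ∎

  fromℤ-homo-× : ∀ m b → fromℤ R (+ m ℤ.* b) ≈ m × fromℤ R b
  fromℤ-homo-× zero    b = reflexive (≡.cong (fromℤ R) (ℤ.*-zeroˡ b))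
  fromℤ-homo-× (suc m) b = begin
    fromℤ R (+ suc m ℤ.* b)          ≡⟨ ≡.cong (fromℤ R) (ℤ.suc-* (+ m) b) ⟩
    fromℤ R (b ℤ.+ + m ℤ.* b)        ≈⟨ fromℤ-homo-+ b (+ m ℤ.* b) ⟩
    fromℤ R b + fromℤ R (+ m ℤ.* b)  ≈⟨ +-congˡ (fromℤ-homo-× m b) ⟩
    suc m × fromℤ R b                ∎

  fromℤ-linear : ∀ a m b Y → fromℤ R a * Y - m × (fromℤ R b * Y) ≈ fromℤ R (a ℤ.- + m ℤ.* b) * Y
  fromℤ-linear a m b Y = begin
    fromℤ R a * Y - m × (fromℤ R b * Y)          ≈⟨ +-congˡ (-‿cong (×-assoc-* m (fromℤ R b) Y)) ⟨
    fromℤ R a * Y - (m × fromℤ R b) * Y          ≈⟨ +-congˡ (-‿cong (*-congʳ (fromℤ-homo-× m b))) ⟨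
    fromℤ R a * Y - fromℤ R mb * Y               ≈⟨ +-congˡ (-‿distribˡ-* (fromℤ R mb) Y) ⟩
    fromℤ R a * Y + (- fromℤ R mb) * Y           ≈⟨ distribʳ Y (fromℤ R a) (- fromℤ R mb) ⟨
    (fromℤ R a - fromℤ R mb) * Y                 ≈⟨ *-congʳ (+-congˡ (fromℤ-homo-neg mb)) ⟨
    (fromℤ R a + fromℤ R (ℤ.- mb)) * Y           ≈⟨ *-congʳ (fromℤ-homo-+ a (ℤ.- mb)) ⟨
    fromℤ R (a ℤ.- mb) * Y                       ∎
    where
    mb = + m ℤ.* b

  [-y]^j≈signℤ[j]*y^j : ∀ y j → (- y) ^ j ≈ fromℤ R (signℤ j) * y ^ j
  [-y]^j≈signℤ[j]*y^j y zero    = sym (trans (*-identityʳ _) (+-identityʳ 1#))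
  [-y]^j≈signℤ[j]*y^j y (suc j) = begin
    - y * (- y) ^ j                       ≈⟨ *-congˡ ([-y]^j≈signℤ[j]*y^j y j) ⟩
    - y * (s * y ^ j)                     ≈⟨ -‿distribˡ-* y (s * y ^ j) ⟨
    - (y * (s * y ^ j))                   ≈⟨ -‿cong (x∙yz≈y∙xz y s (y ^ j)) ⟩
    - (s * (y * y ^ j))                   ≈⟨ -‿distribˡ-* s (y * y ^ j) ⟩
    - s * (y * y ^ j)                     ≈⟨ *-congʳ (fromℤ-homo-neg (signℤ j)) ⟨
    fromℤ R (signℤ (suc j)) * y ^ suc j   ∎
    where
    s = fromℤ R (signℤ j)

  y^r*[-y]^j≈signℤ[j]*y^[r+j] : ∀ y r j → y ^ r * (- y) ^ j ≈ fromℤ R (signℤ j) * y ^ (r ℕ.+ j)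
  y^r*[-y]^j≈signℤ[j]*y^[r+j] y r j = begin
    y ^ r * (- y) ^ j                     ≈⟨ *-congˡ ([-y]^j≈signℤ[j]*y^j y j) ⟩
    y ^ r * (fromℤ R (signℤ j) * y ^ j)   ≈⟨ x∙yz≈y∙xz (y ^ r) (fromℤ R (signℤ j)) (y ^ j) ⟩
    fromℤ R (signℤ j) * (y ^ r * y ^ j)   ≈⟨ *-congˡ (^-homo-* y r j) ⟨
    fromℤ R (signℤ j) * y ^ (r ℕ.+ j)     ∎

  ×≈×1#* : ∀ m x → m × x ≈ (m × 1#) * x
  ×≈×1#* m x = sym (trans (×-assoc-* m 1# x) (×-congʳ m (*-identityˡ x)))

  ×-distribˡ-∑ : ∀ N m (f : ℕ → Carrier) → m × ∑ N f ≈ ∑ N (λ k → m × f k)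
  ×-distribˡ-∑ N m f = begin
    m × ∑ N f                   ≈⟨ ×≈×1#* m (∑ N f) ⟩
    (m × 1#) * ∑ N f            ≈⟨ *-distribˡ-∑ N (m × 1#) f ⟩
    ∑ N (λ k → (m × 1#) * f k)  ≈⟨ ∑-cong N (λ k _ → ×≈×1#* m (f k)) ⟨
    ∑ N (λ k → m × f k)         ∎

  ×-homo-∑ : ∀ N (a : ℕ → ℕ) x → NatSum.∑ N a × x ≈ ∑ N (λ k → a k × x)
  ×-homo-∑ zero    a x = trans (×-congˡ (NatSum.∑-empty a)) (sym (∑-empty (λ k → a k × x)))
  ×-homo-∑ (suc N) a x = begin
    NatSum.∑ (suc N) a × x                ≡⟨ ≡.cong (_× x) (NatSum.∑-suc N a) ⟩
    (a 0 ℕ.+ NatSum.∑ N (a ∘ suc)) × x    ≈⟨ ×-homo-+ x (a 0) (NatSum.∑ N (a ∘ suc)) ⟩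
    a 0 × x + NatSum.∑ N (a ∘ suc) × x    ≈⟨ +-congˡ (×-homo-∑ N (a ∘ suc) x) ⟩
    a 0 × x + ∑ N (λ k → a (suc k) × x)   ≈⟨ ∑-suc N (λ k → a k × x) ⟨
    ∑ (suc N) (λ k → a k × x)             ∎

  ∑-neg : ∀ N (f : ℕ → Carrier) → - ∑ N f ≈ ∑ N (λ k → - f k)
  ∑-neg N f = begin
    - ∑ N f                  ≈⟨ -1*x≈-x (∑ N f) ⟨
    - 1# * ∑ N f             ≈⟨ *-distribˡ-∑ N (- 1#) f ⟩
    ∑ N (λ k → - 1# * f k)   ≈⟨ ∑-cong N (λ k _ → -1*x≈-x (f k)) ⟩
    ∑ N (λ k → - f k)        ∎

  ∑-− : ∀ N (f g : ℕ → Carrier) → ∑ N f - ∑ N g ≈ ∑ N (λ k → f k - g k)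
  ∑-− N f g = trans (+-congˡ (∑-neg N g)) (sym (∑-+ N f (λ k → - g k)))

  sumFromTo≈∑ : ∀ a n (f : ℕ → Carrier) → (∀ k → k < a → f k ≈ 0#) →
                sumFromTo R a n f ≈ ∑ (suc n) f
  sumFromTo≈∑ a zero f f≈0 with a
  ... | zero  = sym (∑-one f)
  ... | suc _ = trans (sym (f≈0 0 (s≤s ℕ.z≤n))) (sym (∑-one f))
  sumFromTo≈∑ a (suc n) f f≈0 with a ℕ.≤? suc n
  ... | yes _   = trans (+-congʳ (sumFromTo≈∑ a n f f≈0)) (sym (∑-snoc (suc n) f))
  ... | no  a≰n =
    sym (∑-zero (suc (suc n)) f (λ k k≤n → f≈0 k (ℕ.≤-<-trans (ℕ.≤-pred k≤n) (ℕ.≰⇒> a≰n))))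

  phi≈∑ : ∀ m d y → phi R m y ≈ ∑ (suc m ℕ.+ d) (λ j → stirling2 m j × y ^ j)
  phi≈∑ m d y = begin
    phi R m y          ≈⟨ sumFromTo≈∑ 0 m P (λ _ ()) ⟩
    ∑ (suc m) P        ≈⟨ ∑-zero-suffix (suc m) d P P≈0 ⟨
    ∑ (suc m ℕ.+ d) P  ∎
    where
    P : ℕ → Carrier
    P j = stirling2 m j × y ^ j
    P≈0 : ∀ j → suc m ≤ j → P j ≈ 0#
    P≈0 j m<j = reflexive (≡.cong (_× y ^ j) (stirling2-vanish m<j))

  signedStirlingTerm : ℕ → ℕ → Carrier → ℕ → Carrier
  signedStirlingTerm n r y k = ((k C r) ℕ.* stirling2 n k) × (fromℤ R (signℤ (k ∸ r)) * y ^ k)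

  wTilde-difference≈∑-signedStirlingTerm : ∀ n r y →
    wTilde R n r y - suc r × wTilde R n (suc r) y ≈ ∑ (suc n) (signedStirlingTerm n r y)
  wTilde-difference≈∑-signedStirlingTerm n r y = begin
    wTilde R n r y - suc r × wTilde R n (suc r) y
      ≈⟨ +-cong (sumFromTo≈∑ 0 n (term r) (λ _ ()))
                (-‿cong (×-congʳ (suc r) (sumFromTo≈∑ 0 n (term (suc r)) (λ _ ())))) ⟩
    ∑ N (term r) - suc r × ∑ N (term (suc r))
      ≈⟨ +-congˡ (-‿cong (×-distribˡ-∑ N (suc r) (term (suc r)))) ⟩
    ∑ N (term r) - ∑ N (λ k → suc r × term (suc r) k)
      ≈⟨ ∑-− N (term r) (λ k → suc r × term (suc r) k) ⟩
    ∑ N (λ k → term r k - suc r × term (suc r) k)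
      ≈⟨ ∑-cong N (λ k _ → termwise k) ⟩
    ∑ N (signedStirlingTerm n r y) ∎
    where
    N : ℕ
    N = suc n
    term : ℕ → ℕ → Carrier
    term q k = (stirling2 n k × fromℤ R (dkr k q)) * y ^ k
    termwise : ∀ k → term r k - suc r × term (suc r) k ≈ signedStirlingTerm n r y k
    termwise k = begin
      (s × fromℤ R (dkr k r)) * y ^ k - suc r × ((s × fromℤ R (dkr k (suc r))) * y ^ k)
        ≈⟨ +-cong (*-congʳ (fromℤ-homo-× s (dkr k r)))
                  (-‿cong (×-congʳ (suc r) (*-congʳ (fromℤ-homo-× s (dkr k (suc r)))))) ⟨
      fromℤ R (+ s ℤ.* dkr k r) * y ^ k - suc r × (fromℤ R (+ s ℤ.* dkr k (suc r)) * y ^ k)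
        ≈⟨ fromℤ-linear (+ s ℤ.* dkr k r) (suc r) (+ s ℤ.* dkr k (suc r)) (y ^ k) ⟩
      fromℤ R (+ s ℤ.* dkr k r ℤ.- + suc r ℤ.* (+ s ℤ.* dkr k (suc r))) * y ^ k
        ≡⟨ ≡.cong (λ i → fromℤ R i * y ^ k) (dkr-difference-scaled s k r) ⟩
      fromℤ R (+ ((k C r) ℕ.* s) ℤ.* signℤ (k ∸ r)) * y ^ k
        ≈⟨ *-congʳ (fromℤ-homo-× ((k C r) ℕ.* s) (signℤ (k ∸ r))) ⟩
      (((k C r) ℕ.* s) × fromℤ R (signℤ (k ∸ r))) * y ^ k
        ≈⟨ ×-assoc-* ((k C r) ℕ.* s) (fromℤ R (signℤ (k ∸ r))) (y ^ k) ⟩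
      signedStirlingTerm n r y k ∎
      where
      s : ℕ
      s = stirling2 n k

  phi-sum≈convolution-sum : ∀ n r y →
    sumFromTo R r n (λ k → ((n C k) ℕ.* stirling2 k r) × phi R (n ∸ k) y)
      ≈ ∑ (suc n) (λ j → binomialConvolution n (λ k → stirling2 k r) (λ k → stirling2 k j) × y ^ j)
  phi-sum≈convolution-sum n r y = begin
    sumFromTo R r n (λ k → c k × phi R (n ∸ k) y)
      ≈⟨ sumFromTo≈∑ r n (λ k → c k × phi R (n ∸ k) y) below-r ⟩
    ∑ N (λ k → c k × phi R (n ∸ k) y)
      ≈⟨ ∑-cong N (λ k k<N → expand k (ℕ.≤-pred k<N)) ⟩
    ∑ N (λ k → ∑ N (λ j → (c k ℕ.* stirling2 (n ∸ k) j) × y ^ j))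
      ≈⟨ ∑-swap N N (λ k j → (c k ℕ.* stirling2 (n ∸ k) j) × y ^ j) ⟩
    ∑ N (λ j → ∑ N (λ k → (c k ℕ.* stirling2 (n ∸ k) j) × y ^ j))
      ≈⟨ ∑-cong N (λ j _ → ×-homo-∑ N (λ k → c k ℕ.* stirling2 (n ∸ k) j) (y ^ j)) ⟨
    ∑ N (λ j → binomialConvolution n (λ k → stirling2 k r) (λ k → stirling2 k j) × y ^ j) ∎
    where
    N : ℕ
    N = suc n
    c : ℕ → ℕ
    c k = (n C k) ℕ.* stirling2 k r
    below-r : ∀ k → k < r → c k × phi R (n ∸ k) y ≈ 0#
    below-r k k<r = reflexive (≡.cong (_× phi R (n ∸ k) y)
                                      (≡.trans (≡.cong ((n C k) ℕ.*_) (stirling2-vanish k<r)) (ℕ.*-zeroʳ (n C k))))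
    expand : ∀ k → k ≤ n → c k × phi R (n ∸ k) y ≈ ∑ N (λ j → (c k ℕ.* stirling2 (n ∸ k) j) × y ^ j)
    expand k k≤n = begin
      c k × phi R (n ∸ k) y
        ≈⟨ ×-congʳ (c k) (phi≈∑ (n ∸ k) k y) ⟩
      c k × ∑ (suc (n ∸ k) ℕ.+ k) (λ j → stirling2 (n ∸ k) j × y ^ j)
        ≡⟨ ≡.cong (λ M → c k × ∑ (suc M) (λ j → stirling2 (n ∸ k) j × y ^ j)) (ℕ.m∸n+n≡m k≤n) ⟩
      c k × ∑ N (λ j → stirling2 (n ∸ k) j × y ^ j)
        ≈⟨ ×-distribˡ-∑ N (c k) (λ j → stirling2 (n ∸ k) j × y ^ j) ⟩
      ∑ N (λ j → c k × (stirling2 (n ∸ k) j × y ^ j))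
        ≈⟨ ∑-cong N (λ j _ → ×-assocˡ (y ^ j) (c k) (stirling2 (n ∸ k) j)) ⟩
      ∑ N (λ j → (c k ℕ.* stirling2 (n ∸ k) j) × y ^ j) ∎

  -- Substituting k = r + j; the summands vanish for k < r (C(k,r) = 0) and for k > n (S(n,k) = 0).
  y^r*∑≈∑-signedStirlingTerm : ∀ n r y →
    y ^ r * ∑ (suc n) (λ j → (((r ℕ.+ j) C r) ℕ.* stirling2 n (r ℕ.+ j)) × (- y) ^ j)
      ≈ ∑ (suc n) (signedStirlingTerm n r y)
  y^r*∑≈∑-signedStirlingTerm n r y = begin
    y ^ r * ∑ N (λ j → a j × (- y) ^ j)      ≈⟨ *-distribˡ-∑ N (y ^ r) (λ j → a j × (- y) ^ j) ⟩
    ∑ N (λ j → y ^ r * (a j × (- y) ^ j))    ≈⟨ ∑-cong N (λ j _ → shift j) ⟩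
    ∑ N (λ j → t (r ℕ.+ j))                  ≈⟨ ∑-zero-prefix r N t t≈0-below ⟨
    ∑ (r ℕ.+ N) t                            ≡⟨ ≡.cong (λ M → ∑ M t) (ℕ.+-comm r N) ⟩
    ∑ (N ℕ.+ r) t                            ≈⟨ ∑-zero-suffix N r t t≈0-above ⟩
    ∑ N t                                    ∎
    where
    N : ℕ
    N = suc n
    a : ℕ → ℕ
    a j = ((r ℕ.+ j) C r) ℕ.* stirling2 n (r ℕ.+ j)
    t : ℕ → Carrier
    t = signedStirlingTerm n r y
    u : ℕ → Carrier
    u k = fromℤ R (signℤ (k ∸ r)) * y ^ k
    shift : ∀ j → y ^ r * (a j × (- y) ^ j) ≈ t (r ℕ.+ j)
    shift j = begin
      y ^ r * (a j × (- y) ^ j)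
        ≈⟨ ×-comm-* (a j) (y ^ r) ((- y) ^ j) ⟩
      a j × (y ^ r * (- y) ^ j)
        ≈⟨ ×-congʳ (a j) (y^r*[-y]^j≈signℤ[j]*y^[r+j] y r j) ⟩
      a j × (fromℤ R (signℤ j) * y ^ (r ℕ.+ j))
        ≡⟨ ≡.cong (λ i → a j × (fromℤ R (signℤ i) * y ^ (r ℕ.+ j))) (ℕ.m+n∸m≡n r j) ⟨
      t (r ℕ.+ j) ∎
    t≈0-below : ∀ k → k < r → t k ≈ 0#
    t≈0-below k k<r = reflexive (≡.cong (λ b → (b ℕ.* stirling2 n k) × u k) (k>n⇒nCk≡0 k<r))
    t≈0-above : ∀ k → N ≤ k → t k ≈ 0#
    t≈0-above k n<k =
      reflexive (≡.cong (_× u k) (≡.trans (≡.cong ((k C r) ℕ.*_) (stirling2-vanish n<k)) (ℕ.*-zeroʳ (k C r))))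

  y^r*phi-sum≈∑-signedStirlingTerm : ∀ n r y →
    y ^ r * sumFromTo R r n (λ k → ((n C k) ℕ.* stirling2 k r) × phi R (n ∸ k) (- y))
      ≈ ∑ (suc n) (signedStirlingTerm n r y)
  y^r*phi-sum≈∑-signedStirlingTerm n r y = begin
    y ^ r * sumFromTo R r n (λ k → ((n C k) ℕ.* stirling2 k r) × phi R (n ∸ k) (- y))
      ≈⟨ *-congˡ (phi-sum≈convolution-sum n r (- y)) ⟩
    y ^ r * ∑ (suc n) (λ j → binomialConvolution n (λ k → stirling2 k r) (λ k → stirling2 k j) × (- y) ^ j)
      ≈⟨ *-congˡ (∑-cong (suc n) (λ j _ → ×-congˡ (stirling2-convolution n ≡.refl))) ⟩
    y ^ r * ∑ (suc n) (λ j → (((r ℕ.+ j) C r) ℕ.* stirling2 n (r ℕ.+ j)) × (- y) ^ j)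
      ≈⟨ y^r*∑≈∑-signedStirlingTerm n r y ⟩
    ∑ (suc n) (signedStirlingTerm n r y) ∎

open import Algebra.Definitions.RawSemiring using (_×_; _^_)
open import Data.Nat using (ℕ; suc; _∸_)

mainTheorem9 : {c ℓ : Level} (R : CommutativeRing c ℓ) (n r : ℕ) (y : CommutativeRing.Carrier R) →
    let open CommutativeRing R
        S = Semiring.rawSemiring semiring
    in wTilde R n r y - (_×_ S (suc r) (wTilde R n (suc r) y))
       ≈ _^_ S y r * sumFromTo R r n (λ k → _×_ S ((n C k) Data.Nat.* stirling2 k r) (phi R (n ∸ k) (- y)))
mainTheorem9 R n r y = trans (wTilde-difference≈∑-signedStirlingTerm R n r y)
                             (sym (y^r*phi-sum≈∑-signedStirlingTerm R n r y))
  where open CommutativeRing R using (trans; sym)
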